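{- Let $G$ and $H$ be two nontrivial connected graphs. For $\ast\in\{\boxtimes,\circ\}$, it holds that $C_{cc}(G\ast H)=\alpha(G\ast H)$.
   Context: All graphs are finite, simple and undirected. Cycle convexity on a graph $G$: for $S\subseteq V(G)$, the cycle interval $\langle S\rangle$ is $S$ together with every vertex $w\in V(G)$ that lies on a cycle of the induced subgraph $G[S\cup\{w\}]$ passing through $w$. $S$ is (cycle) convex if $\langle S\rangle=S$. The cycle convexity number $C_{cc}(G)$ is the maximum cardinality of a proper (i.e. $\neq V(G)$) convex subset of $V(G)$. $\alpha$ denotes the independence number. The strong product $G\boxtimes H$ has vertex set $V(G)\times V(H)$, with $(g_1,h_1)\sim(g_2,h_2)$ iff ($g_1\sim g_2$ and $h_1=h_2$) or ($g_1=g_2$ and $h_1\sim h_2$) or ($g_1\sim g_2$ and $h_1\sim h_2$). The lexicographic product $G\circ H$ has vertex set $V(G)\times V(H)$, with $(g_1,h_1)\sim(g_2,h_2)$ iff $g_1\sim g_2$, or ($g_1=g_2$ and $h_1\sim h_2$). A graph is nontrivial if it has at least two vertices. -}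

module Defs where

open import Data.Nat using (ℕ; _*_; _≤_)
open import Data.Bool using (Bool; true; false; T; _∧_; _∨_)
open import Data.Fin using (Fin; remQuot)
open import Data.Fin.Properties using (_≟_)
open import Data.Fin.Subset using (Subset; _∈_; _∉_; _∪_; ⁅_⁆; ⊤; ∣_∣)
open import Data.List using (List; []; _∷_; _++_; [_]; length)
open import Data.List.Relation.Unary.All using (All)
open import Data.List.Relation.Unary.Linked using (Linked)
open import Data.List.Relation.Unary.Unique.Propositional using (Unique)
open import Data.Product using (Σ; _×_; _,_; ∃)
open import Data.Sum using (_⊎_)
open import Relation.Nullary using (¬_)
open import Relation.Nullary.Decidable using (⌊_⌋)
open import Relation.Binary.PropositionalEquality using (_≡_)
open import Relation.Binary.Construct.Closure.ReflexiveTransitive using (Star)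

record Graph : Set where
  constructor mkGraph
  field
    n   : ℕ
    adj : Fin n → Fin n → Bool

open Graph public

Vertex : Graph → Set
Vertex G = Fin (n G)

Edge : (G : Graph) → Vertex G → Vertex G → Set
Edge G u v = T (adj G u v)

Simple : Graph → Set
Simple G = (∀ u v → adj G u v ≡ adj G v u) × (∀ v → adj G v v ≡ false)

Connected : Graph → Set
Connected G = ∀ u v → Star (Edge G) u v

Nontrivial : Graph → Set
Nontrivial G = 2 ≤ n G

-- a cycle of the induced subgraph G[X] passing through w:
-- distinct vertices w, v1, ..., vk (k ≥ 2) of X, consecutive ones adjacent,
-- and vk adjacent to w
CycleThrough : (G : Graph) → Subset (n G) → Vertex G → Set
CycleThrough G X w =
  Σ (List (Vertex G)) λ vs →
    (2 ≤ length vs) × Unique (w ∷ vs) × All (_∈ X) (w ∷ vs)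
    × Linked (Edge G) ((w ∷ vs) ++ [ w ])

InInterval : (G : Graph) → Subset (n G) → Vertex G → Set
InInterval G S w = w ∈ S ⊎ CycleThrough G (S ∪ ⁅ w ⁆) w

Convex : (G : Graph) → Subset (n G) → Set
Convex G S = ∀ w → InInterval G S w → w ∈ S

ProperConvex : (G : Graph) → Subset (n G) → Set
ProperConvex G S = Convex G S × ¬ (S ≡ ⊤)

Independent : (G : Graph) → Subset (n G) → Set
Independent G S = ∀ u v → u ∈ S → v ∈ S → ¬ Edge G u v

IsMaxCard : {m : ℕ} → (Subset m → Set) → ℕ → Set
IsMaxCard {m} P k = (∃ λ (S : Subset m) → P S × ∣ S ∣ ≡ k) × (∀ S → P S → ∣ S ∣ ≤ k)

IsCycleConvexityNumber : (G : Graph) → ℕ → Set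
IsCycleConvexityNumber G = IsMaxCard (ProperConvex G)

IsIndependenceNumber : (G : Graph) → ℕ → Set
IsIndependenceNumber G = IsMaxCard (Independent G)

-- products; vertex (g , h) is encoded as combine g h : Fin (n G * n H)
_==_ : {k : ℕ} → Fin k → Fin k → Bool
i == j = ⌊ i ≟ j ⌋

strongAdj : (G H : Graph) → Fin (n G) × Fin (n H) → Fin (n G) × Fin (n H) → Bool
strongAdj G H (g₁ , h₁) (g₂ , h₂) =
  (adj G g₁ g₂ ∧ (h₁ == h₂)) ∨ ((g₁ == g₂) ∧ adj H h₁ h₂) ∨ (adj G g₁ g₂ ∧ adj H h₁ h₂)

lexAdj : (G H : Graph) → Fin (n G) × Fin (n H) → Fin (n G) × Fin (n H) → Bool
lexAdj G H (g₁ , h₁) (g₂ , h₂) = adj G g₁ g₂ ∨ ((g₁ == g₂) ∧ adj H h₁ h₂)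

_⊠_ : Graph → Graph → Graph
G ⊠ H = mkGraph (n G * n H) λ x y → strongAdj G H (remQuot (n H) x) (remQuot (n H) y)

_∘ₗ_ : Graph → Graph → Graph
G ∘ₗ H = mkGraph (n G * n H) λ x y → lexAdj G H (remQuot (n H) x) (remQuot (n H) y)

data ProductKind : Set where
  strong lexicographic : ProductKind

product : ProductKind → Graph → Graph → Graph
product strong        G H = G ⊠ H
product lexicographic G H = G ∘ₗ H

-- An independent set admits no cycle through an outside vertex, so it is convex, and it
-- is proper once the graph has an edge. Conversely, a convex set containing an edge xy
-- contains every common neighbour of x and y, as they form a triangle. In G ⊠ H and G ∘ H
-- a triangle on any edge of such a set puts a vertical edge (g , h)(g , h′) into it;
-- triangles then carry the ends of a vertical edge along the edges of G, and those of a
-- horizontal edge along the edges of H, so by connectivity the set is everything. Hence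
-- the proper convex sets are exactly the independent sets, and the two maxima agree.
module Submission where

open import Defs
open import Data.Nat using (ℕ; zero; suc; _*_; _≤_; z≤n; s≤s; _≟_)
open import Data.Nat.Properties using (≤-pred; ≤∧≢⇒<)
open import Data.Bool using (Bool; T; _∧_)
open import Data.Bool.Properties using (T-∧; T-∨)
open import Data.Fin using (Fin; remQuot; combine) renaming (zero to fzero; suc to fsuc)
open import Data.Fin.Properties using (remQuot-combine; combine-remQuot; all?)
  renaming (_≟_ to _≟ᶠ_)
open import Data.Fin.Subset using (Subset; _∈_; _∪_; ⁅_⁆; ⊤; ∣_∣) renaming (⊥ to ∅)
open import Data.Fin.Subset.Properties
  using ( anySubset?; _∈?_; x∈p∪q⁻; p⊆p∪q; q⊆p∪q; x∈⁅x⁆; x∈⁅y⁆⇒x≡y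
        ; ∣p∣≤n; ∣⊥∣≡0; ∉⊥; ∈⊤; ⊆⊤; ⊆-antisym)
open import Data.List using ([]; _∷_)
open import Data.List.Relation.Unary.All using ([]; _∷_)
open import Data.List.Relation.Unary.AllPairs using ([]; _∷_)
open import Data.List.Relation.Unary.Linked using ([-]; _∷_)
open import Data.Product using (Σ; ∃; _×_; _,_; proj₁; proj₂; uncurry)
open import Data.Empty using (⊥-elim)
open import Data.Sum using (inj₁; inj₂)
open import Function.Bundles using (Equivalence)
open import Relation.Nullary using (¬_; Dec; yes; no; contradiction)
open import Relation.Nullary.Decidable using (fromWitness; toWitness; _→-dec_; _×-dec_; ¬?; T?)
open import Relation.Binary.PropositionalEquality using (_≡_; _≢_; ≢-sym; refl; sym; subst; subst₂)
open import Relation.Binary.Construct.Closure.ReflexiveTransitive using (Star; ε; _◅_)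

open Equivalence using (to; from)

Loopless : Graph → Set
Loopless G = ∀ v → ¬ Edge G v v

simple⇒loopless : (G : Graph) → Simple G → Loopless G
simple⇒loopless G (_ , noLoop) v e = subst T (noLoop v) e

edge-sym : (G : Graph) → Simple G → ∀ {u v} → Edge G u v → Edge G v u
edge-sym G (adj-sym , _) {u} {v} = subst T (adj-sym u v)

nontrivial⇒distinct : ∀ {k} → 2 ≤ k → (v : Fin k) → ∃ λ w → v ≢ w
nontrivial⇒distinct (s≤s (s≤s _)) fzero    = fsuc fzero , λ ()
nontrivial⇒distinct (s≤s (s≤s _)) (fsuc v) = fzero , λ ()

neighbour : (G : Graph) → Nontrivial G → Connected G → ∀ v → ∃ λ u → Edge G v u
neighbour G nt conn v with nontrivial⇒distinct nt v
... | w , v≢w with conn v w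
...   | ε     = contradiction refl v≢w
...   | e ◅ _ = _ , e

vertex : ∀ {k} → 2 ≤ k → Fin k
vertex (s≤s _) = fzero

independent⇒convex : (G : Graph) (S : Subset (n G)) → Independent G S → Convex G S
independent⇒convex G S indep w (inj₁ w∈S) = w∈S
independent⇒convex G S indep w
  (inj₂ (v₁ ∷ v₂ ∷ _ , _ , ((w≢v₁ ∷ w≢v₂ ∷ _) ∷ _) , (_ ∷ v₁∈ ∷ v₂∈ ∷ _) , (_ ∷ e₁₂ ∷ _))) =
  ⊥-elim (indep v₁ v₂ (outside-w v₁∈ (≢-sym w≢v₁)) (outside-w v₂∈ (≢-sym w≢v₂)) e₁₂)
  where
  outside-w : ∀ {v} → v ∈ S ∪ ⁅ w ⁆ → v ≢ w → v ∈ S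
  outside-w v∈ v≢w with x∈p∪q⁻ S ⁅ w ⁆ v∈
  ... | inj₁ v∈S = v∈S
  ... | inj₂ v∈w = contradiction (x∈⁅y⁆⇒x≡y w v∈w) v≢w
independent⇒convex G S indep w (inj₂ (_ ∷ [] , s≤s () , _))

independent⇒properConvex : (G : Graph) → ∀ {x y} → Edge G x y
  → (S : Subset (n G)) → Independent G S → ProperConvex G S
independent⇒properConvex G {x} {y} e S indep =
  independent⇒convex G S indep , λ S≡⊤ →
    indep x y (subst (x ∈_) (sym S≡⊤) ∈⊤) (subst (y ∈_) (sym S≡⊤) ∈⊤) e

TriangleClosed : (G : Graph) → Subset (n G) → Set
TriangleClosed G S = ∀ {x y w} → x ∈ S → y ∈ S
  → Edge G x y → Edge G w x → Edge G y w → w ∈ S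

convex⇒triangleClosed : (G : Graph) → Loopless G → (S : Subset (n G))
  → Convex G S → TriangleClosed G S
convex⇒triangleClosed G loopless S convex {x} {y} {w} x∈S y∈S exy ewx eyw =
  convex w (inj₂ (x ∷ y ∷ [] , s≤s (s≤s z≤n)
    , ((distinct ewx ∷ ≢-sym (distinct eyw) ∷ []) ∷ (distinct exy ∷ []) ∷ [] ∷ [])
    , (q⊆p∪q S ⁅ w ⁆ (x∈⁅x⁆ w) ∷ p⊆p∪q ⁅ w ⁆ x∈S ∷ p⊆p∪q ⁅ w ⁆ y∈S ∷ [])
    , (ewx ∷ exy ∷ eyw ∷ [-])))
  where
  distinct : ∀ {a b} → Edge G a b → a ≢ b
  distinct {a} e refl = loopless a e

independent? : (G : Graph) (S : Subset (n G)) → Dec (Independent G S)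
independent? G S = all? λ u → all? λ v → (u ∈? S) →-dec ((v ∈? S) →-dec ¬? (T? (adj G u v)))

∅-independent : (G : Graph) → Independent G ∅
∅-independent G u v u∈∅ = contradiction u∈∅ ∉⊥

maxCard-exists : ∀ {m} {Q : Subset m → Set} → (∀ S → Dec (Q S)) → Q ∅ → ∃ (IsMaxCard Q)
maxCard-exists {m} {Q} Q? Q∅ = search m (λ S _ → ∣p∣≤n S)
  where
  search : ∀ b → (∀ S → Q S → ∣ S ∣ ≤ b) → ∃ (IsMaxCard Q)
  search zero    bound = zero , (∅ , Q∅ , ∣⊥∣≡0 m) , bound
  search (suc b) bound with anySubset? (λ S → Q? S ×-dec (∣ S ∣ ≟ suc b))
  ... | yes attained  = suc b , attained , bound
  ... | no ¬attained = search b λ S QS →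
    ≤-pred (≤∧≢⇒< (bound S QS) (λ eq → ¬attained (S , QS , eq)))

isMaxCard-resp : ∀ {m} {Q R : Subset m → Set} {k}
  → (∀ S → Q S → R S) → (∀ S → R S → Q S) → IsMaxCard Q k → IsMaxCard R k
isMaxCard-resp Q⇒R R⇒Q ((S , QS , ∣S∣≡k) , bound) =
  (S , Q⇒R S QS , ∣S∣≡k) , λ S′ RS′ → bound S′ (R⇒Q S′ RS′)

Ccc≡α : Graph → Set
Ccc≡α G = Σ ℕ λ k → IsCycleConvexityNumber G k × IsIndependenceNumber G k

properConvex⇒independent⇒Ccc≡α : (G : Graph) → ∀ {x y} → Edge G x y
  → (∀ S → ProperConvex G S → Independent G S) → Ccc≡α G
properConvex⇒independent⇒Ccc≡α G e properConvex⇒independent =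
  let k , α-max = maxCard-exists (independent? G) (∅-independent G)
  in k , isMaxCard-resp (independent⇒properConvex G e) properConvex⇒independent α-max , α-max

module Products (G H : Graph) where

  Pair : Set
  Pair = Vertex G × Vertex H

  data StrongEdge : Pair → Pair → Set where
    horizontal : ∀ {g g′ h} → Edge G g g′ → StrongEdge (g , h) (g′ , h)
    vertical   : ∀ {g h h′} → Edge H h h′ → StrongEdge (g , h) (g , h′)
    diagonal   : ∀ {g g′ h h′} → Edge G g g′ → Edge H h h′ → StrongEdge (g , h) (g′ , h′)

  data LexEdge : Pair → Pair → Set where
    across : ∀ {g g′ h h′} → Edge G g g′ → LexEdge (g , h) (g′ , h′)
    within : ∀ {g h h′} → Edge H h h′ → LexEdge (g , h) (g , h′)

  ProductEdge : ProductKind → Pair → Pair → Set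
  ProductEdge strong        = StrongEdge
  ProductEdge lexicographic = LexEdge

  pairAdj : ProductKind → Pair → Pair → Bool
  pairAdj strong        = strongAdj G H
  pairAdj lexicographic = lexAdj G H

  strongAdj⇒strongEdge : ∀ {p q} → T (strongAdj G H p q) → StrongEdge p q
  strongAdj⇒strongEdge {_ , h} {_ , h′} t with to T-∨ t
  ... | inj₁ t₁ with to T-∧ t₁
  ...   | e , h≡h′ with toWitness {a? = h ≟ᶠ h′} h≡h′
  ...     | refl = horizontal e
  strongAdj⇒strongEdge {g , _} {g′ , _} t | inj₂ t₂ with to T-∨ t₂
  ... | inj₂ t₃ = uncurry diagonal (to T-∧ t₃)
  ... | inj₁ t₃ with to T-∧ t₃
  ...   | g≡g′ , f with toWitness {a? = g ≟ᶠ g′} g≡g′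
  ...     | refl = vertical f

  lexAdj⇒lexEdge : ∀ {p q} → T (lexAdj G H p q) → LexEdge p q
  lexAdj⇒lexEdge {g , _} {g′ , _} t with to T-∨ t
  ... | inj₁ e = across e
  ... | inj₂ t₂ with to T-∧ t₂
  ...   | g≡g′ , f with toWitness {a? = g ≟ᶠ g′} g≡g′
  ...     | refl = within f

  pairAdj⇒productEdge : ∀ op {p q} → T (pairAdj op p q) → ProductEdge op p q
  pairAdj⇒productEdge strong        = strongAdj⇒strongEdge
  pairAdj⇒productEdge lexicographic = lexAdj⇒lexEdge

  productEdge⇒pairAdj : ∀ op {p q} → ProductEdge op p q → T (pairAdj op p q)
  productEdge⇒pairAdj strong (horizontal {g} {g′} {h} e) =
    from (T-∨ {adj G g g′ ∧ (h == h)}) (inj₁ (from T-∧ (e , fromWitness refl)))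
  productEdge⇒pairAdj strong (vertical {g} {h} {h′} f) =
    from (T-∨ {adj G g g ∧ (h == h′)})
      (inj₂ (from (T-∨ {(g == g) ∧ adj H h h′}) (inj₁ (from T-∧ (fromWitness refl , f)))))
  productEdge⇒pairAdj strong (diagonal {g} {g′} {h} {h′} e f) =
    from (T-∨ {adj G g g′ ∧ (h == h′)})
      (inj₂ (from (T-∨ {(g == g′) ∧ adj H h h′}) (inj₂ (from T-∧ (e , f)))))
  productEdge⇒pairAdj lexicographic (across e) = from T-∨ (inj₁ e)
  productEdge⇒pairAdj lexicographic (within {g} {h} {h′} f) =
    from (T-∨ {adj G g g}) (inj₂ (from T-∧ (fromWitness refl , f)))

  horizontalEdge : ∀ op {g g′ h} → Edge G g g′ → ProductEdge op (g , h) (g′ , h)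
  horizontalEdge strong        = horizontal
  horizontalEdge lexicographic = across

  verticalEdge : ∀ op {g h h′} → Edge H h h′ → ProductEdge op (g , h) (g , h′)
  verticalEdge strong        = vertical
  verticalEdge lexicographic = within

  diagonalEdge : ∀ op {g g′ h h′} → Edge G g g′ → Edge H h h′ → ProductEdge op (g , h) (g′ , h′)
  diagonalEdge strong        e f = diagonal e f
  diagonalEdge lexicographic e _ = across e

  productEdge-irreflexive : Loopless G → Loopless H → ∀ op p → ¬ ProductEdge op p p
  productEdge-irreflexive loopG loopH strong        (g , _) (horizontal e) = loopG g e
  productEdge-irreflexive loopG loopH strong        (_ , h) (vertical f)   = loopH h f
  productEdge-irreflexive loopG loopH strong        (g , _) (diagonal e _) = loopG g e
  productEdge-irreflexive loopG loopH lexicographic (g , _) (across e)     = loopG g e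
  productEdge-irreflexive loopG loopH lexicographic (_ , h) (within f)     = loopH h f

  -- Unlike product op G H, its vertex type is Fin (n G * n H) also for a variable op.
  productGraph : ProductKind → Graph
  productGraph op = mkGraph (n G * n H) λ x y → pairAdj op (remQuot (n H) x) (remQuot (n H) y)

  product≡productGraph : ∀ op → product op G H ≡ productGraph op
  product≡productGraph strong        = refl
  product≡productGraph lexicographic = refl

  ⟦_⟧ : Pair → Fin (n G * n H)
  ⟦_⟧ = uncurry combine

  _∈ₚ_ : Pair → Subset (n G * n H) → Set
  p ∈ₚ S = ⟦ p ⟧ ∈ S

  ⟦remQuot⟧ : ∀ x → ⟦ remQuot (n H) x ⟧ ≡ x
  ⟦remQuot⟧ = combine-remQuot {n G} (n H)

  edge⇒productEdge : ∀ op {x y} → Edge (productGraph op) x y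
    → ProductEdge op (remQuot (n H) x) (remQuot (n H) y)
  edge⇒productEdge op = pairAdj⇒productEdge op

  productEdge⇒edge : ∀ op {p q} → ProductEdge op p q → Edge (productGraph op) ⟦ p ⟧ ⟦ q ⟧
  productEdge⇒edge op {g , h} {g′ , h′} pq =
    subst₂ (λ p q → T (pairAdj op p q))
      (sym (remQuot-combine g h)) (sym (remQuot-combine g′ h′)) (productEdge⇒pairAdj op pq)

  productGraph-loopless : Loopless G → Loopless H → ∀ op → Loopless (productGraph op)
  productGraph-loopless loopG loopH op x e =
    productEdge-irreflexive loopG loopH op _ (edge⇒productEdge op e)

module ProductConvexity (G H : Graph) (simpleG : Simple G) (simpleH : Simple H)
  (nontrivialG : Nontrivial G) (nontrivialH : Nontrivial H)
  (connectedG : Connected G) (connectedH : Connected H) where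

  open Products G H

  VerticalEdgeIn : Subset (n G * n H) → Set
  VerticalEdgeIn S = ∃ λ g → ∃ λ h → ∃ λ h′ → Edge H h h′ × (g , h) ∈ₚ S × (g , h′) ∈ₚ S

  module Spreading (op : ProductKind) (S : Subset (n G * n H))
    (closed : TriangleClosed (productGraph op) S) where

    closedₚ : ∀ {p q r} → p ∈ₚ S → q ∈ₚ S
      → ProductEdge op p q → ProductEdge op r p → ProductEdge op q r → r ∈ₚ S
    closedₚ p∈S q∈S pq rp qr =
      closed p∈S q∈S (productEdge⇒edge op pq) (productEdge⇒edge op rp) (productEdge⇒edge op qr)

    hor : ∀ {g g′ h} → Edge G g g′ → ProductEdge op (g , h) (g′ , h)
    hor = horizontalEdge op
    ver : ∀ {g h h′} → Edge H h h′ → ProductEdge op (g , h) (g , h′)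
    ver = verticalEdge op
    diag : ∀ {g g′ h h′} → Edge G g g′ → Edge H h h′ → ProductEdge op (g , h) (g′ , h′)
    diag = diagonalEdge op

    symG : ∀ {g g′} → Edge G g g′ → Edge G g′ g
    symG = edge-sym G simpleG
    symH : ∀ {h h′} → Edge H h h′ → Edge H h′ h
    symH = edge-sym H simpleH

    verticalEdge-spreads : ∀ {h h′} → Edge H h h′ → ∀ {g g′} → Star (Edge G) g g′
      → (g , h) ∈ₚ S → (g , h′) ∈ₚ S → (g′ , h) ∈ₚ S × (g′ , h′) ∈ₚ S
    verticalEdge-spreads f ε        a b = a , b
    verticalEdge-spreads f (e ◅ es) a b = verticalEdge-spreads f es
      (closedₚ a b (ver f) (hor (symG e)) (diag e (symH f)))
      (closedₚ a b (ver f) (diag (symG e) (symH f)) (hor e))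

    horizontalEdge-spreads : ∀ {g g′} → Edge G g g′ → ∀ {h h′} → Star (Edge H) h h′
      → (g , h) ∈ₚ S → (g′ , h) ∈ₚ S → (g , h′) ∈ₚ S × (g′ , h′) ∈ₚ S
    horizontalEdge-spreads e ε        a b = a , b
    horizontalEdge-spreads e (f ◅ fs) a b = horizontalEdge-spreads e fs
      (closedₚ a b (hor e) (ver (symH f)) (diag (symG e) f))
      (closedₚ a b (hor e) (diag (symG e) (symH f)) (ver f))

    verticalEdge⇒everything : VerticalEdgeIn S → ∀ p → p ∈ₚ S
    verticalEdge⇒everything (g , h , h′ , f , a , b) (g* , h*) =
      let g′ , e = neighbour G nontrivialG connectedG g*
          column-g* = verticalEdge-spreads f (connectedG g g*) a b
          column-g′ = verticalEdge-spreads f (connectedG g g′) a b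
      in proj₁ (horizontalEdge-spreads e (connectedH h h*) (proj₁ column-g*) (proj₁ column-g′))

  edge⇒verticalEdge : ∀ op S → TriangleClosed (productGraph op) S
    → ∀ {p q} → p ∈ₚ S → q ∈ₚ S → ProductEdge op p q → VerticalEdgeIn S
  edge⇒verticalEdge strong S closed {g , h} p∈S q∈S (horizontal e) =
    let h′ , f = neighbour H nontrivialH connectedH h
    in g , h , h′ , f , p∈S , closedₚ q∈S p∈S (hor (symG e)) (diag e (symH f)) (ver f)
    where open Spreading strong S closed
  edge⇒verticalEdge strong S closed {g , h} p∈S q∈S (vertical f) = g , h , _ , f , p∈S , q∈S
  edge⇒verticalEdge strong S closed {g , h} p∈S q∈S (diagonal e f) =
    g , h , _ , f , p∈S , closedₚ p∈S q∈S (diag e f) (ver (symH f)) (hor (symG e))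
    where open Spreading strong S closed
  edge⇒verticalEdge lexicographic S closed {q = g′ , h′} p∈S q∈S (across e) =
    let h″ , f = neighbour H nontrivialH connectedH h′
    in g′ , h′ , h″ , f , q∈S , closedₚ p∈S q∈S (across e) (across (symG e)) (within f)
    where open Spreading lexicographic S closed
  edge⇒verticalEdge lexicographic S closed {g , h} p∈S q∈S (within f) = g , h , _ , f , p∈S , q∈S

  triangleClosed-edge⇒⊤ : ∀ op S → TriangleClosed (productGraph op) S
    → ∀ {x y} → x ∈ S → y ∈ S → Edge (productGraph op) x y → S ≡ ⊤
  triangleClosed-edge⇒⊤ op S closed {x} {y} x∈S y∈S e =
    ⊆-antisym ⊆⊤ λ {z} _ → subst (_∈ S) (⟦remQuot⟧ z) (everything (remQuot (n H) z))
    where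
    open Spreading op S closed
    decode : ∀ {z} → z ∈ S → remQuot (n H) z ∈ₚ S
    decode {z} = subst (_∈ S) (sym (⟦remQuot⟧ z))
    everything : ∀ p → p ∈ₚ S
    everything = verticalEdge⇒everything
      (edge⇒verticalEdge op S closed (decode x∈S) (decode y∈S) (edge⇒productEdge op e))

  properConvex⇒independent : ∀ op S
    → ProperConvex (productGraph op) S → Independent (productGraph op) S
  properConvex⇒independent op S (convex , S≢⊤) x y x∈S y∈S e =
    S≢⊤ (triangleClosed-edge⇒⊤ op S closed x∈S y∈S e)
    where
    loopless : Loopless (productGraph op)
    loopless = productGraph-loopless (simple⇒loopless G simpleG) (simple⇒loopless H simpleH) op
    closed : TriangleClosed (productGraph op) S
    closed = convex⇒triangleClosed (productGraph op) loopless S convex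

  productGraph-hasEdge : ∀ op → ∃ λ x → ∃ λ y → Edge (productGraph op) x y
  productGraph-hasEdge op =
    let _ , e = neighbour G nontrivialG connectedG (vertex nontrivialG)
    in _ , _ , productEdge⇒edge op (horizontalEdge op {h = vertex nontrivialH} e)

mainTheorem9 : (G H : Graph) → Simple G → Simple H
    → Nontrivial G → Nontrivial H → Connected G → Connected H
    → (op : ProductKind)
    → Σ ℕ λ k → IsCycleConvexityNumber (product op G H) k × IsIndependenceNumber (product op G H) k
mainTheorem9 G H simpleG simpleH nontrivialG nontrivialH connectedG connectedH op =
  subst Ccc≡α (sym (product≡productGraph op))
    (properConvex⇒independent⇒Ccc≡α (productGraph op)
      (proj₂ (proj₂ (productGraph-hasEdge op))) (properConvex⇒independent op))
  where
  open Products G H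
  open ProductConvexity G H simpleG simpleH nontrivialG nontrivialH connectedG connectedH
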